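{- Let $b\geq 2$ be an integer. For any positive integers $n$ and $d$, the infinite arithmetic progression $\{n+jd: j\geq 0\}$ contains a positive integer that is not $b$-anti-Niven; that is, there is no $b$-anti-Niven $d$-AP of infinite length.
   Context: For a positive integer $n$ with base-$b$ expansion $n=\sum_{j=0}^m a_jb^j$ ($0\leq a_j\leq b-1$), $s_b(n)=\sum_{j=0}^m a_j$. A positive integer $n$ is $b$-anti-Niven if $\gcd(n,s_b(n))=1$. A $d$-AP of infinite length is a sequence $\{n+jd:j\geq 0\}$ with $n,d$ positive integers; it is $b$-anti-Niven if every term is $b$-anti-Niven. -}

module Defs where

open import Data.Nat using (ℕ; zero; suc; _+_; _*_; _≤_; NonZero)
open import Data.Nat.DivMod using (_/_; _%_)
open import Data.Nat.GCD using (gcd)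
open import Relation.Binary.PropositionalEquality using (_≡_)

-- Base-b digit sum with fuel: digitSumAux b f n is s_b(n) whenever f ≥ n
-- (each step divides n by b ≥ 2, so n steps suffice).
digitSumAux : (b : ℕ) → .{{NonZero b}} → ℕ → ℕ → ℕ
digitSumAux b zero    n = 0
digitSumAux b (suc f) zero = 0
digitSumAux b (suc f) n@(suc _) = n % b + digitSumAux b f (n / b)

s : (b : ℕ) → .{{NonZero b}} → ℕ → ℕ
s b n = digitSumAux b n n

AntiNiven : (b : ℕ) → .{{NonZero b}} → ℕ → Set
AntiNiven b n = gcd n (s b n) ≡ 1

{-# OPTIONS --safe #-}
-- Put q = 1 + (b-1)d, so that (b-1)d ≡ -1 (mod q). The term n·q = n + n(b-1)·d of the
-- progression is divisible by q; above its digits we write the block d·q·(b^e - 1), which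
-- keeps the number in the progression and divisible by q, and whose digit sum is e(b-1)
-- because any multiplier k ≤ b^e of b^e - 1 has digit sum e(b-1). The total digit sum
-- s_b(nq) + e(b-1) is divisible by q for e = d·s_b(nq) + q·d, as (b-1)d ≡ -1 (mod q).
module Submission where

open import Defs
open import Data.Nat using (ℕ; zero; suc; _+_; _*_; _∸_; _^_; _≤_; _<_; _≤?_; NonZero; z≤n; s≤s; s≤s⁻¹)
open import Data.Nat.Properties
open import Data.Nat.DivMod using (_/_; _%_; m≡m%n+[m/n]*n; m%n<n; m<n⇒m%n≡m; [m+kn]%n≡m%n; 0/n≡0; m/n<m; m<n*o⇒m/o<n)
open import Data.Nat.Divisibility using (_∣_; divides)
open import Data.Nat.Coprimality using (gcd≡1⇒coprime)
open import Data.Nat.Tactic.RingSolver using (solve-∀)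
open import Algebra.Properties.CommutativeSemigroup +-commutativeSemigroup using (interchange)
open import Data.Product using (∃-syntax; _×_; _,_; proj₁)
open import Data.Empty using (⊥-elim)
open import Relation.Nullary using (¬_; yes; no)
open import Relation.Binary.PropositionalEquality

n<m^n : ∀ m → 1 < m → ∀ n → n < m ^ n
n<m^n m 1<m zero    = s≤s z≤n
n<m^n m@(suc _) 1<m (suc n) = begin-strict
  suc n      ≤⟨ n<m^n m 1<m n ⟩
  m ^ n      ≡⟨ sym (*-identityˡ (m ^ n)) ⟩
  1 * m ^ n  <⟨ *-monoˡ-< (m ^ n) {{m^n≢0 m n}} 1<m ⟩
  m * m ^ n  ∎
  where open ≤-Reasoning

module DigitSum (b : ℕ) .{{_ : NonZero b}} (1<b : 1 < b) where

  0<b : 0 < b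
  0<b = ≤-trans (s≤s z≤n) 1<b

  digit-unique : ∀ {a a'} c c' → a < b → a' < b → a + c * b ≡ a' + c' * b → a ≡ a' × c ≡ c'
  digit-unique {a} {a'} c c' a<b a'<b eq =
    a≡a' , *-cancelʳ-≡ c c' b (+-cancelˡ-≡ a _ _ (trans eq (cong (_+ c' * b) (sym a≡a'))))
    where
    open ≡-Reasoning
    a≡a' : a ≡ a'
    a≡a' = begin
      a                 ≡⟨ sym (m<n⇒m%n≡m a<b) ⟩
      a % b             ≡⟨ sym ([m+kn]%n≡m%n a c b) ⟩
      (a + c * b) % b   ≡⟨ cong (_% b) eq ⟩
      (a' + c' * b) % b ≡⟨ [m+kn]%n≡m%n a' c' b ⟩
      a' % b            ≡⟨ m<n⇒m%n≡m a'<b ⟩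
      a'                ∎

  [1+n]/b≤n : ∀ n → suc n / b ≤ n
  [1+n]/b≤n n = s≤s⁻¹ (m/n<m (suc n) b 1<b)

  digitSumAux-fuel : ∀ f g n → n ≤ f → n ≤ g → digitSumAux b f n ≡ digitSumAux b g n
  digitSumAux-fuel zero    zero    zero    _ _ = refl
  digitSumAux-fuel zero    (suc g) zero    _ _ = refl
  digitSumAux-fuel (suc f) zero    zero    _ _ = refl
  digitSumAux-fuel (suc f) (suc g) zero    _ _ = refl
  digitSumAux-fuel (suc f) (suc g) (suc n) (s≤s n≤f) (s≤s n≤g) =
    cong (suc n % b +_) (digitSumAux-fuel f g (suc n / b) (≤-trans ([1+n]/b≤n n) n≤f) (≤-trans ([1+n]/b≤n n) n≤g))

  s[n]≡n%b+s[n/b] : ∀ n → s b n ≡ n % b + s b (n / b)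
  s[n]≡n%b+s[n/b] zero    = sym (cong₂ _+_ (m<n⇒m%n≡m 0<b) (cong (s b) (0/n≡0 b)))
  s[n]≡n%b+s[n/b] (suc n) = cong (suc n % b +_) (digitSumAux-fuel n (suc n / b) (suc n / b) ([1+n]/b≤n n) ≤-refl)

  s[a+c*b]≡a+s[c] : ∀ a c → a < b → s b (a + c * b) ≡ a + s b c
  s[a+c*b]≡a+s[c] a c a<b with digit-unique (x / b) c (m%n<n x b) a<b (sym (m≡m%n+[m/n]*n x b))
    where x = a + c * b
  ... | low , high = trans (s[n]≡n%b+s[n/b] (a + c * b)) (cong₂ _+_ low (cong (s b) high))

  s[y+x*b^k]≡s[y]+s[x] : ∀ k y x → y < b ^ k → s b (y + x * b ^ k) ≡ s b y + s b x
  s[y+x*b^k]≡s[y]+s[x] zero    zero    x _ = cong (s b) (*-identityʳ x)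
  s[y+x*b^k]≡s[y]+s[x] zero    (suc y) x (s≤s ())
  s[y+x*b^k]≡s[y]+s[x] (suc k) y       x y<b^k+1 = begin
    s b (y + x * b ^ suc k)                  ≡⟨ cong (λ t → s b (t + x * b ^ suc k)) (m≡m%n+[m/n]*n y b) ⟩
    s b (y % b + y / b * b + x * (b * b ^ k)) ≡⟨ cong (s b) (shift (y % b) (y / b) x b (b ^ k)) ⟩
    s b (y % b + (y / b + x * b ^ k) * b)    ≡⟨ s[a+c*b]≡a+s[c] (y % b) (y / b + x * b ^ k) (m%n<n y b) ⟩
    y % b + s b (y / b + x * b ^ k)          ≡⟨ cong (y % b +_) (s[y+x*b^k]≡s[y]+s[x] k (y / b) x y/b<b^k) ⟩
    y % b + (s b (y / b) + s b x)            ≡⟨ sym (+-assoc (y % b) _ _) ⟩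
    y % b + s b (y / b) + s b x              ≡⟨ cong (_+ s b x) (sym (s[n]≡n%b+s[n/b] y)) ⟩
    s b y + s b x                            ∎
    where
    open ≡-Reasoning
    shift : ∀ a c x b B → a + c * b + x * (b * B) ≡ a + (c + x * B) * b
    shift = solve-∀
    y/b<b^k : y / b < b ^ k
    y/b<b^k = m<n*o⇒m/o<n (subst (y <_) (*-comm b (b ^ k)) y<b^k+1)

  complementary-digits : ∀ {a a' c c'} → a < b → a' < b → suc (a + a') + c * b ≡ c' * b → suc (a + a') ≡ b × suc c ≡ c'
  complementary-digits {a} {a'} {c} {c'} a<b a'<b eq with b ≤? suc (a + a')
  ... | no  b≰ = ⊥-elim (1+n≢0 (proj₁ (digit-unique c c' (≰⇒> b≰) 0<b eq)))
  ... | yes b≤ with digit-unique (suc c) c' r<b 0<b eq'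
    where
    r : ℕ
    r = suc (a + a') ∸ b
    r+b : r + b ≡ suc (a + a')
    r+b = m∸n+n≡m b≤
    r<b : r < b
    r<b = +-cancelʳ-< b r b (subst (_< b + b) (sym r+b) (+-mono-≤-< a<b a'<b))
    eq' : r + suc c * b ≡ 0 + c' * b
    eq' = trans (sym (+-assoc r b (c * b))) (trans (cong (_+ c * b) r+b) eq)
  ... | r≡0 , high = trans (sym (m∸n+n≡m b≤)) (cong (_+ b) r≡0) , high

  s[y]+s[z]≡e*[b∸1] : ∀ e y z → suc (y + z) ≡ b ^ e → s b y + s b z ≡ e * (b ∸ 1)
  s[y]+s[z]≡e*[b∸1] zero    zero    zero    refl = refl
  s[y]+s[z]≡e*[b∸1] (suc e) y       z       eq
    with complementary-digits (m%n<n y b) (m%n<n z b)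
           (trans (regroup (y % b) (y / b) (z % b) (z / b) b) (trans digits (trans eq (*-comm b (b ^ e)))))
    where
    regroup : ∀ y₀ y₁ z₀ z₁ b → suc (y₀ + z₀) + (y₁ + z₁) * b ≡ suc ((y₀ + y₁ * b) + (z₀ + z₁ * b))
    regroup = solve-∀
    digits : suc ((y % b + y / b * b) + (z % b + z / b * b)) ≡ suc (y + z)
    digits = cong₂ (λ u v → suc (u + v)) (sym (m≡m%n+[m/n]*n y b)) (sym (m≡m%n+[m/n]*n z b))
  ... | low , high = begin
    s b y + s b z                                      ≡⟨ cong₂ _+_ (s[n]≡n%b+s[n/b] y) (s[n]≡n%b+s[n/b] z) ⟩
    y % b + s b (y / b) + (z % b + s b (z / b))        ≡⟨ interchange (y % b) _ _ _ ⟩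
    y % b + z % b + (s b (y / b) + s b (z / b))        ≡⟨ cong₂ _+_ (cong (_∸ 1) low) (s[y]+s[z]≡e*[b∸1] e (y / b) (z / b) high) ⟩
    (b ∸ 1) + e * (b ∸ 1)                              ∎
    where open ≡-Reasoning

  s[k*[b^e∸1]]≡e*[b∸1] : ∀ e k → 1 ≤ k → k ≤ b ^ e → s b (k * (b ^ e ∸ 1)) ≡ e * (b ∸ 1)
  s[k*[b^e∸1]]≡e*[b∸1] e (suc x) _ k≤b^e = begin
    s b (suc x * P)         ≡⟨ cong (s b) split ⟩
    s b (z + x * b ^ e)     ≡⟨ s[y+x*b^k]≡s[y]+s[x] e z x z<b^e ⟩
    s b z + s b x           ≡⟨ +-comm (s b z) (s b x) ⟩
    s b x + s b z           ≡⟨ s[y]+s[z]≡e*[b∸1] e x z (trans (cong suc x+z≡P) 1+P≡b^e) ⟩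
    e * (b ∸ 1)             ∎
    where
    open ≡-Reasoning
    P z : ℕ
    P = b ^ e ∸ 1
    z = P ∸ x
    1+P≡b^e : suc P ≡ b ^ e
    1+P≡b^e = m+[n∸m]≡n (m^n>0 b e)
    x≤P : x ≤ P
    x≤P = s≤s⁻¹ (subst (suc x ≤_) (sym 1+P≡b^e) k≤b^e)
    x+z≡P : x + z ≡ P
    x+z≡P = m+[n∸m]≡n x≤P
    z<b^e : z < b ^ e
    z<b^e = subst (z <_) 1+P≡b^e (s≤s (m∸n≤m P x))
    -- (x+1)(b^e - 1) = (b^e - 1 - x) + x·b^e: the digits of x placed above those of its complement.
    expand : ∀ x z → suc x * (x + z) ≡ z + x * suc (x + z)
    expand = solve-∀
    split : suc x * P ≡ z + x * b ^ e
    split = begin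
      suc x * P              ≡⟨ cong (suc x *_) (sym x+z≡P) ⟩
      suc x * (x + z)        ≡⟨ expand x z ⟩
      z + x * suc (x + z)    ≡⟨ cong (λ w → z + x * w) (trans (cong suc x+z≡P) 1+P≡b^e) ⟩
      z + x * b ^ e          ∎

  progression-meets-common-multiple : ∀ n d → 1 ≤ d →
    ∃[ j ] (suc ((b ∸ 1) * d) ∣ n + j * d × suc ((b ∸ 1) * d) ∣ s b (n + j * d))
  progression-meets-common-multiple n d 1≤d = j , subst (λ t → q ∣ t × q ∣ s b t) m≡n+j*d (q∣m , q∣s[m])
    where
    B q S e P X m j : ℕ
    B = b ∸ 1
    q = suc (B * d)
    S = s b (n * q)
    e = d * S + q * d
    P = b ^ e ∸ 1
    X = b ^ (n * q)
    m = n * q + (d * q) * P * X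
    j = n * B + q * P * X
    m≡n+j*d : m ≡ n + j * d
    m≡n+j*d = progression n B d P X
      where
      progression : ∀ n B d P X → n * (1 + B * d) + (d * (1 + B * d)) * P * X ≡ n + (n * B + (1 + B * d) * P * X) * d
      progression = solve-∀
    dq≤b^e : d * q ≤ b ^ e
    dq≤b^e = ≤-trans (subst (_≤ e) (*-comm q d) (m≤n+m (q * d) (d * S))) (<⇒≤ (n<m^n b 1<b e))
    1≤dq : 1 ≤ d * q
    1≤dq = *-mono-≤ 1≤d (s≤s z≤n)
    s[m]≡S+e*B : s b m ≡ S + e * B
    s[m]≡S+e*B = trans (s[y+x*b^k]≡s[y]+s[x] (n * q) (n * q) ((d * q) * P) (n<m^n b 1<b (n * q)))
                       (cong (S +_) (s[k*[b^e∸1]]≡e*[b∸1] e (d * q) 1≤dq dq≤b^e))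
    q∣m : q ∣ m
    q∣m = divides (n + d * P * X) (factor n B d P X)
      where
      factor : ∀ n B d P X → n * (1 + B * d) + (d * (1 + B * d)) * P * X ≡ (n + d * P * X) * (1 + B * d)
      factor = solve-∀
    q∣s[m] : q ∣ s b m
    q∣s[m] = divides (S + d * B) (trans s[m]≡S+e*B (factor S B d))
      where
      factor : ∀ S B d → S + (d * S + (1 + B * d) * d) * B ≡ (S + d * B) * (1 + B * d)
      factor = solve-∀

common-divisor⇒¬AntiNiven : ∀ b .{{_ : NonZero b}} {q m} → q ≢ 1 → q ∣ m → q ∣ s b m → ¬ AntiNiven b m
common-divisor⇒¬AntiNiven b q≢1 q∣m q∣s[m] gcd≡1 = q≢1 (gcd≡1⇒coprime gcd≡1 (q∣m , q∣s[m]))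

theorem2p3 : (b : ℕ) → .{{_ : NonZero b}} → 2 ≤ b →
    (n d : ℕ) → 1 ≤ n → 1 ≤ d →
    ∃[ j ] ¬ AntiNiven b (n + j * d)
theorem2p3 b 1<b@(s≤s (s≤s _)) n d _ 1≤d@(s≤s _)
  with DigitSum.progression-meets-common-multiple b 1<b n d 1≤d
... | j , q∣term , q∣s[term] = j , common-divisor⇒¬AntiNiven b (λ ()) q∣term q∣s[term]
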